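{- Let $T$ be a threshold graph with threshold ordering $v_1,\dots,v_n$. Let $c_1,\dots,c_m$ be the vertices on the dominating side listed in order, with $c_r=v_{t_r}$; let $P_r=\{v_1,\dots,v_{t_r-1}\}$; let $I$ be the set of vertices on the isolated side; and let $I_r=\{v_j\in I: j>t_r\}$. Then \[ D(T,x)=\sum_{r=1}^m x^{\alpha_r}(1+x)^{\beta_r}+\varepsilon x^{|I|}, \] where $\beta_r=|P_r|$, $\alpha_r=|I_r|+1$ for $1\le r\le m$, and $\varepsilon=1$ if $I$ is a dominating set of $T$ and $\varepsilon=0$ otherwise.
   Context: A set $S\subseteq V(G)$ is dominating if every vertex is in $S$ or adjacent to a vertex of $S$; the domination polynomial is $D(G,x)=\sum_{S\text{ dominating}}x^{|S|}$. A graph $T$ on $n$ vertices is a threshold graph if there is an ordering $v_1,\dots,v_n$ of its vertices (a threshold ordering) such that each $v_j$ is either isolated or adjacent to all of $v_1,\dots,v_{j-1}$ in the induced subgraph on $\{v_1,\dots,v_j\}$. Vertices added as adjacent to all earlier vertices are on the dominating side; vertices added as isolated are on the isolated side. -}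

module Defs where

open import Data.Nat using (ℕ; zero; suc; _+_; _*_; _∸_; _≟_; _<ᵇ_)
open import Data.Bool using (Bool; true; false; not; if_then_else_)
import Data.Bool as Bool
open import Data.Fin using (Fin; toℕ; _<_)
open import Data.Fin.Properties using (any?; all?)
open import Data.Fin.Subset using (Subset; _∈_; ∣_∣)
open import Data.Fin.Subset.Properties using (_∈?_)
open import Data.Vec using (Vec; []; _∷_; tabulate)
open import Data.List using (List; []; _∷_; map; _++_; filter; length; foldr; allFin)
open import Data.Product using (Σ; ∃; _×_; _,_)
open import Data.Sum using (_⊎_)
open import Relation.Nullary using (¬_; Dec; yes; no)
open import Relation.Nullary.Decidable using (_⊎-dec_; _×-dec_)
open import Relation.Binary.PropositionalEquality using (_≡_)

record Graph (n : ℕ) : Set₁ where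
  field
    Adj     : Fin n → Fin n → Set
    adj?    : ∀ u v → Dec (Adj u v)
    sym     : ∀ {u v} → Adj u v → Adj v u
    irrefl  : ∀ {u} → ¬ Adj u u
open Graph public

Dominating : ∀ {n} → Graph n → Subset n → Set
Dominating G S = ∀ v → v ∈ S ⊎ ∃ λ u → u ∈ S × Adj G u v

dominating? : ∀ {n} (G : Graph n) (S : Subset n) → Dec (Dominating G S)
dominating? G S = all? λ v → (v ∈? S) ⊎-dec any? (λ u → (u ∈? S) ×-dec adj? G u v)

allSubsets : (n : ℕ) → List (Subset n)
allSubsets zero = [] ∷ []
allSubsets (suc n) = map (false ∷_) (allSubsets n) ++ map (true ∷_) (allSubsets n)

-- Polynomials with natural-number coefficients, represented by their
-- coefficient sequence: p k = coefficient of x^k.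

Poly : Set
Poly = ℕ → ℕ

0P 1P X : Poly
0P _ = 0
1P zero = 1
1P (suc _) = 0
X (suc zero) = 1
X _ = 0

_+P_ : Poly → Poly → Poly
(p +P q) k = p k + q k

sumTo : ℕ → (ℕ → ℕ) → ℕ
sumTo zero f = f 0
sumTo (suc k) f = sumTo k f + f (suc k)

_*P_ : Poly → Poly → Poly
(p *P q) k = sumTo k (λ i → p i * q (k ∸ i))

_^P_ : Poly → ℕ → Poly
p ^P zero = 1P
p ^P suc e = p *P (p ^P e)

ΣP : ∀ {A : Set} → List A → (A → Poly) → Poly
ΣP xs f = foldr (λ a acc → f a +P acc) 0P xs

D : ∀ {n} → Graph n → Poly
D {n} G k = length (filter (λ S → dominating? G S ×-dec (∣ S ∣ ≟ k)) (allSubsets n))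

-- The threshold ordering v_1,…,v_n is the natural
-- order on Fin n; side j = true means v_j was added on the dominating
-- side (adjacent to all earlier vertices), false means isolated side.

IsThresholdOrdering : ∀ {n} → Graph n → (Fin n → Bool) → Set
IsThresholdOrdering G side =
  ∀ i j → i < j → (side j ≡ true → Adj G i j) × (side j ≡ false → ¬ Adj G i j)

isolatedSide : ∀ {n} → (Fin n → Bool) → Subset n
isolatedSide side = tabulate (λ i → not (side i))

isolatedAfter : ∀ {n} → (Fin n → Bool) → Fin n → Subset n
isolatedAfter side t = tabulate (λ j → if toℕ t <ᵇ toℕ j then not (side j) else false)

before : ∀ {n} → Fin n → Subset n
before t = tabulate (λ j → toℕ j <ᵇ toℕ t)

indicator : ∀ {P : Set} → Dec P → ℕ
indicator (yes _) = 1
indicator (no _) = 0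

thresholdRHS : ∀ {n} → Graph n → (Fin n → Bool) → Poly
thresholdRHS {n} G side =
  ΣP (filter (λ t → side t Bool.≟ true) (allFin n))
     (λ t → (X ^P (∣ isolatedAfter side t ∣ + 1)) *P ((1P +P X) ^P ∣ before t ∣))
  +P (λ k → indicator (dominating? G (isolatedSide side)) * (X ^P ∣ isolatedSide side ∣) k)

{-# OPTIONS --safe #-}
-- Induction on n, deleting the last vertex v_n of the threshold ordering.  If v_n is on the
-- isolated side it has no neighbours, so it lies in every dominating set and
-- D(T) = x D(T - v_n); on the right-hand side every α_r and |I| grow by one, so it is
-- multiplied by x as well.  If v_n is on the dominating side it is adjacent to every other
-- vertex: the dominating sets containing it are all sets containing it, contributing
-- x (1+x)^(n-1), which is exactly the new summand for c_m = v_n; the dominating sets avoiding it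
-- are the nonempty dominating sets of T - v_n, and the other summands and ε do not change.
module Submission where

open import Defs hiding (sym)
open import Data.Nat using (ℕ; zero; suc; _+_; _*_; _∸_; _≟_; _<ᵇ_; _<?_)
import Data.Nat as ℕ
open import Data.Nat.Properties
  using (+-assoc; +-identityʳ; *-identityˡ; *-distribʳ-+; *-zeroʳ; suc-injective; <-asym; <-irrefl; ≤⇒≯;
         +-commutativeSemigroup)
open import Algebra.Properties.CommutativeSemigroup +-commutativeSemigroup using (interchange; xy∙z≈xz∙y)
open import Data.Bool using (Bool; true; false; not; if_then_else_)
import Data.Bool as Bool
open import Data.Bool.Properties using (not-¬)
open import Data.Fin using (Fin; zero; suc; toℕ; fromℕ; inject₁; _<_)
open import Data.Fin.Properties using (toℕ-inject₁; toℕ-fromℕ; inject₁ℕ<; ≤fromℕ)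
open import Data.Fin.Relation.Unary.Top using (view; ‵fromℕ; ‵inj₁)
open import Data.Fin.Subset using (Subset; _∈_; _∉_; ∣_∣; inside; outside; ⊤; ⊥; Nonempty)
open import Data.Fin.Subset.Properties using (∣⊤∣≡n; ∣⊥∣≡0)
open import Data.Vec using ([]; _∷_; _∷ʳ_; here; there; tabulate; replicate)
open import Data.Vec.Properties using (tabulate-cong; tabulate-allFin; map-const)
open import Data.List using (List; []; _∷_; _++_; [_]; map; filter; length; allFin)
import Data.List as List
open import Data.List.Properties
  using (filter-++; length-++; length-map; filter-≐; filter-none; filter-accept; filter-reject; foldr-map; map-tabulate)
import Data.List.Relation.Unary.All as All
open import Data.Product using (∃; _×_; _,_; proj₁; proj₂)
open import Data.Sum using (_⊎_; inj₁; inj₂)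
open import Data.Empty using (⊥-elim)
open import Function using (_∘_; const; id)
open import Relation.Nullary using (¬_; Dec; yes; no; does)
open import Relation.Nullary.Decidable using (_×-dec_; dec-true; dec-false)
open import Relation.Unary using (Decidable; _≐_)
open import Relation.Binary.PropositionalEquality hiding ([_])

-- Polynomials

shift : Poly → Poly
shift p zero = 0
shift p (suc k) = p k

shift-cong : ∀ {p q} → p ≗ q → shift p ≗ shift q
shift-cong p≗q zero = refl
shift-cong p≗q (suc k) = p≗q k

shift-+P : ∀ p q → shift (p +P q) ≗ (shift p +P shift q)
shift-+P p q zero = refl
shift-+P p q (suc k) = refl

shift-interchange : ∀ a b c d →
  ((a +P shift b) +P shift (c +P shift d)) ≗ ((a +P shift c) +P shift (b +P shift d))
shift-interchange a b c d k = begin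
  a k + shift b k + shift (c +P shift d) k          ≡⟨ cong (a k + shift b k +_) (shift-+P c (shift d) k) ⟩
  a k + shift b k + (shift c k + shift (shift d) k) ≡⟨ interchange (a k) _ _ _ ⟩
  a k + shift c k + (shift b k + shift (shift d) k) ≡⟨ cong (a k + shift c k +_) (shift-+P b (shift d) k) ⟨
  a k + shift c k + shift (b +P shift d) k          ∎
  where open ≡-Reasoning

sumTo-cong : ∀ k {f g : ℕ → ℕ} → f ≗ g → sumTo k f ≡ sumTo k g
sumTo-cong zero f≗g = f≗g 0
sumTo-cong (suc k) f≗g = cong₂ _+_ (sumTo-cong k f≗g) (f≗g (suc k))

sumTo-suc : ∀ k f → sumTo (suc k) f ≡ f 0 + sumTo k (f ∘ suc)
sumTo-suc zero f = refl
sumTo-suc (suc k) f = begin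
  sumTo (suc k) f + f (suc (suc k))             ≡⟨ cong (_+ f (suc (suc k))) (sumTo-suc k f) ⟩
  f 0 + sumTo k (f ∘ suc) + f (suc (suc k))     ≡⟨ +-assoc (f 0) _ _ ⟩
  f 0 + (sumTo k (f ∘ suc) + f (suc (suc k)))   ∎
  where open ≡-Reasoning

sumTo-+ : ∀ k f g → sumTo k (λ i → f i + g i) ≡ sumTo k f + sumTo k g
sumTo-+ zero f g = refl
sumTo-+ (suc k) f g = begin
  sumTo k (λ i → f i + g i) + (f (suc k) + g (suc k))   ≡⟨ cong (_+ (f (suc k) + g (suc k))) (sumTo-+ k f g) ⟩
  sumTo k f + sumTo k g + (f (suc k) + g (suc k))       ≡⟨ interchange (sumTo k f) _ _ _ ⟩
  sumTo k f + f (suc k) + (sumTo k g + g (suc k))       ∎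
  where open ≡-Reasoning

sumTo-head : ∀ k f → (∀ i → f (suc i) ≡ 0) → sumTo k f ≡ f 0
sumTo-head zero f tail≡0 = refl
sumTo-head (suc k) f tail≡0 = begin
  sumTo k f + f (suc k)  ≡⟨ cong₂ _+_ (sumTo-head k f tail≡0) (tail≡0 k) ⟩
  f 0 + 0                ≡⟨ +-identityʳ (f 0) ⟩
  f 0                    ∎
  where open ≡-Reasoning

*P-congˡ : ∀ {p p′} q → p ≗ p′ → (p *P q) ≗ (p′ *P q)
*P-congˡ q p≗p′ k = sumTo-cong k (λ i → cong (_* q (k ∸ i)) (p≗p′ i))

*P-distribʳ-+P : ∀ p q r → ((p +P q) *P r) ≗ ((p *P r) +P (q *P r))
*P-distribʳ-+P p q r k =
  trans (sumTo-cong k (λ i → *-distribʳ-+ (r (k ∸ i)) (p i) (q i))) (sumTo-+ k _ _)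

*P-identityˡ : ∀ q → (1P *P q) ≗ q
*P-identityˡ q k = trans (sumTo-head k _ (λ _ → refl)) (*-identityˡ (q k))

shift-*P : ∀ p q → (shift p *P q) ≗ shift (p *P q)
shift-*P p q zero = refl
shift-*P p q (suc k) = sumTo-suc k _

X≗shift-1P : X ≗ shift 1P
X≗shift-1P zero = refl
X≗shift-1P (suc zero) = refl
X≗shift-1P (suc (suc k)) = refl

X-*P : ∀ q → (X *P q) ≗ shift q
X-*P q k = begin
  (X *P q) k          ≡⟨ *P-congˡ q X≗shift-1P k ⟩
  (shift 1P *P q) k   ≡⟨ shift-*P 1P q k ⟩
  shift (1P *P q) k   ≡⟨ shift-cong (*P-identityˡ q) k ⟩
  shift q k           ∎
  where open ≡-Reasoning

X^suc-*P : ∀ a q → ((X ^P suc a) *P q) ≗ shift ((X ^P a) *P q)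
X^suc-*P a q k = trans (*P-congˡ q (X-*P (X ^P a)) k) (shift-*P (X ^P a) q k)

1+X-*P : ∀ q → ((1P +P X) *P q) ≗ (q +P shift q)
1+X-*P q k = trans (*P-distribʳ-+P 1P X q k) (cong₂ _+_ (*P-identityˡ q k) (X-*P q k))

module _ {A : Set} where

  ΣP-++ : ∀ (xs ys : List A) f → ΣP (xs ++ ys) f ≗ (ΣP xs f +P ΣP ys f)
  ΣP-++ [] ys f k = refl
  ΣP-++ (x ∷ xs) ys f k = trans (cong (f x k +_) (ΣP-++ xs ys f k)) (sym (+-assoc (f x k) _ _))

  ΣP-cong : ∀ (xs : List A) {f g} → (∀ a → f a ≗ g a) → ΣP xs f ≗ ΣP xs g
  ΣP-cong [] f≗g k = refl
  ΣP-cong (x ∷ xs) f≗g k = cong₂ _+_ (f≗g x k) (ΣP-cong xs f≗g k)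

  ΣP-shift : ∀ (xs : List A) f → ΣP xs (shift ∘ f) ≗ shift (ΣP xs f)
  ΣP-shift [] f zero = refl
  ΣP-shift [] f (suc k) = refl
  ΣP-shift (x ∷ xs) f k =
    trans (cong (shift (f x) k +_) (ΣP-shift xs f k)) (sym (shift-+P (f x) (ΣP xs f) k))

-- Counting subsets by size

filter-map : ∀ {A B : Set} {P : B → Set} (P? : Decidable P) (f : A → B) xs →
  filter P? (map f xs) ≡ map f (filter (P? ∘ f) xs)
filter-map P? f [] = refl
filter-map P? f (x ∷ xs) with does (P? (f x))
... | true = cong (f x ∷_) (filter-map P? f xs)
... | false = filter-map P? f xs

-- D G is sizePoly (dominating? G) by definition.
sizePoly : ∀ {n} {P : Subset n → Set} → Decidable P → Poly
sizePoly {n} P? k = length (filter (λ S → P? S ×-dec (∣ S ∣ ≟ k)) (allSubsets n))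

module _ {n : ℕ} {P : Subset n → Set} (P? : Decidable P) where

  sizePoly-cong : ∀ {Q} (Q? : Decidable Q) → P ≐ Q → sizePoly P? ≗ sizePoly Q?
  sizePoly-cong Q? (P⊆Q , Q⊆P) k =
    cong length (filter-≐ _ _ ((λ (p , s) → P⊆Q p , s) , (λ (q , s) → Q⊆P q , s)) (allSubsets n))

  sizePoly-∅ : (∀ S → ¬ P S) → sizePoly P? ≗ 0P
  sizePoly-∅ ¬P k =
    cong length (filter-none _ (All.universal (λ S → ¬P S ∘ proj₁) (allSubsets n)))

sizePoly-∷ : ∀ {n} {P : Subset (suc n) → Set} (P? : Decidable P) →
  sizePoly P? ≗ (sizePoly (P? ∘ (outside ∷_)) +P shift (sizePoly (P? ∘ (inside ∷_))))
sizePoly-∷ {n} P? k = begin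
  sizePoly P? k
    ≡⟨ cong length (filter-++ R? (map (outside ∷_) (allSubsets n)) _) ⟩
  length (filter R? (map (outside ∷_) (allSubsets n)) ++ filter R? (map (inside ∷_) (allSubsets n)))
    ≡⟨ length-++ (filter R? (map (outside ∷_) (allSubsets n))) ⟩
  length (filter R? (map (outside ∷_) (allSubsets n))) + length (filter R? (map (inside ∷_) (allSubsets n)))
    ≡⟨ cong₂ _+_ (length-filter-map (outside ∷_)) (length-filter-map (inside ∷_)) ⟩
  sizePoly (P? ∘ (outside ∷_)) k + length (filter (R? ∘ (inside ∷_)) (allSubsets n))
    ≡⟨ cong (sizePoly (P? ∘ (outside ∷_)) k +_) (count-inside k) ⟩
  sizePoly (P? ∘ (outside ∷_)) k + shift (sizePoly (P? ∘ (inside ∷_))) k ∎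
  where
  open ≡-Reasoning
  R? = λ S → P? S ×-dec (∣ S ∣ ≟ k)
  length-filter-map : ∀ f → length (filter R? (map f (allSubsets n))) ≡ length (filter (R? ∘ f) (allSubsets n))
  length-filter-map f =
    trans (cong length (filter-map R? f (allSubsets n))) (length-map f (filter (R? ∘ f) (allSubsets n)))
  count-inside : ∀ k → length (filter (λ S → P? (inside ∷ S) ×-dec (suc ∣ S ∣ ≟ k)) (allSubsets n))
                       ≡ shift (sizePoly (P? ∘ (inside ∷_))) k
  count-inside zero = cong length (filter-none _ (All.universal (λ S ()) (allSubsets n)))
  count-inside (suc k) = cong length (filter-≐ _ _
    ((λ (p , s) → p , suc-injective s) , (λ (p , s) → p , cong suc s)) (allSubsets n))

sizePoly-∷ʳ : ∀ {n} {P : Subset (suc n) → Set} (P? : Decidable P) →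
  sizePoly P? ≗ (sizePoly (P? ∘ (_∷ʳ outside)) +P shift (sizePoly (P? ∘ (_∷ʳ inside))))
sizePoly-∷ʳ {zero} {P} P? k =
  trans (sizePoly-∷ P? k)
        (cong₂ _+_ (sizePoly-cong (P? ∘ (outside ∷_)) (P? ∘ (_∷ʳ outside)) singleton k)
                   (shift-cong (sizePoly-cong (P? ∘ (inside ∷_)) (P? ∘ (_∷ʳ inside)) singleton) k))
  where
  singleton : ∀ {b} → (P ∘ (b ∷_)) ≐ (P ∘ (_∷ʳ b))
  singleton = (λ { {[]} p → p }) , (λ { {[]} p → p })
sizePoly-∷ʳ {suc n} P? k = begin
  sizePoly P? k
    ≡⟨ sizePoly-∷ P? k ⟩
  (sizePoly (P? ∘ (outside ∷_)) +P shift (sizePoly (P? ∘ (inside ∷_)))) k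
    ≡⟨ cong₂ _+_ (sizePoly-∷ʳ (P? ∘ (outside ∷_)) k) (shift-cong (sizePoly-∷ʳ (P? ∘ (inside ∷_))) k) ⟩
  ((out-out +P shift out-in) +P shift (in-out +P shift in-in)) k
    ≡⟨ shift-interchange out-out out-in in-out in-in k ⟩
  ((out-out +P shift in-out) +P shift (out-in +P shift in-in)) k
    ≡⟨ cong₂ _+_ (sizePoly-∷ (P? ∘ (_∷ʳ outside)) k) (shift-cong (sizePoly-∷ (P? ∘ (_∷ʳ inside))) k) ⟨
  (sizePoly (P? ∘ (_∷ʳ outside)) +P shift (sizePoly (P? ∘ (_∷ʳ inside)))) k ∎
  where
  open ≡-Reasoning
  -- Indexed by the membership of the first and of the last vertex; since (b ∷ S) ∷ʳ c
  -- reduces to b ∷ (S ∷ʳ c), both orders of peeling give these same four polynomials.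
  out-out out-in in-out in-in : Poly
  out-out = sizePoly (P? ∘ (outside ∷_) ∘ (_∷ʳ outside))
  out-in = sizePoly (P? ∘ (outside ∷_) ∘ (_∷ʳ inside))
  in-out = sizePoly (P? ∘ (inside ∷_) ∘ (_∷ʳ outside))
  in-in = sizePoly (P? ∘ (inside ∷_) ∘ (_∷ʳ inside))

sizePoly-full : ∀ {n} {P : Subset n → Set} (P? : Decidable P) → (∀ S → P S) →
  sizePoly P? ≗ ((1P +P X) ^P n)
sizePoly-full {zero} P? all zero =
  cong length (filter-accept (λ S → P? S ×-dec (∣ S ∣ ≟ 0)) (all [] , refl))
sizePoly-full {zero} P? all (suc k) =
  cong length (filter-reject (λ S → P? S ×-dec (∣ S ∣ ≟ suc k)) (λ ()))
sizePoly-full {suc n} P? all k = begin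
  sizePoly P? k
    ≡⟨ sizePoly-∷ P? k ⟩
  sizePoly (P? ∘ (outside ∷_)) k + shift (sizePoly (P? ∘ (inside ∷_))) k
    ≡⟨ cong₂ _+_ (sizePoly-full (P? ∘ (outside ∷_)) (all ∘ (outside ∷_)) k)
                 (shift-cong (sizePoly-full (P? ∘ (inside ∷_)) (all ∘ (inside ∷_))) k) ⟩
  ((1P +P X) ^P n) k + shift ((1P +P X) ^P n) k
    ≡⟨ 1+X-*P ((1P +P X) ^P n) k ⟨
  ((1P +P X) ^P suc n) k ∎
  where open ≡-Reasoning

-- Deleting the last vertex

deleteLast : ∀ {n} → Graph (suc n) → Graph n
deleteLast G = record
  { Adj    = λ u v → Adj G (inject₁ u) (inject₁ v)
  ; adj?   = λ u v → adj? G (inject₁ u) (inject₁ v)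
  ; sym    = Graph.sym G
  ; irrefl = irrefl G
  }

DominatedBy : ∀ {n} → Graph n → Subset n → Fin n → Set
DominatedBy G S v = v ∈ S ⊎ ∃ λ u → u ∈ S × Adj G u v

inject₁-∈-∷ʳ⁺ : ∀ {n b} {S : Subset n} {v} → v ∈ S → inject₁ v ∈ S ∷ʳ b
inject₁-∈-∷ʳ⁺ here = here
inject₁-∈-∷ʳ⁺ (there v∈S) = there (inject₁-∈-∷ʳ⁺ v∈S)

inject₁-∈-∷ʳ⁻ : ∀ {n b} {S : Subset n} {v} → inject₁ v ∈ S ∷ʳ b → v ∈ S
inject₁-∈-∷ʳ⁻ {S = _ ∷ _} {zero} here = here
inject₁-∈-∷ʳ⁻ {S = _ ∷ _} {suc v} (there v∈S) = there (inject₁-∈-∷ʳ⁻ v∈S)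

fromℕ-∈-∷ʳinside : ∀ {n} (S : Subset n) → fromℕ n ∈ S ∷ʳ inside
fromℕ-∈-∷ʳinside [] = here
fromℕ-∈-∷ʳinside (_ ∷ S) = there (fromℕ-∈-∷ʳinside S)

fromℕ-∉-∷ʳoutside : ∀ {n} (S : Subset n) → fromℕ n ∉ S ∷ʳ outside
fromℕ-∉-∷ʳoutside [] ()
fromℕ-∉-∷ʳoutside (_ ∷ S) (there ℓ∈S) = fromℕ-∉-∷ʳoutside S ℓ∈S

dominating-nonempty : ∀ {n} (G : Graph (suc n)) {S} → Dominating G S → Nonempty S
dominating-nonempty G d with d zero
... | inj₁ 0∈S = zero , 0∈S
... | inj₂ (u , u∈S , _) = u , u∈S

module _ {n} (G : Graph (suc n)) {S : Subset n} {b : Bool} where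

  private
    ℓ = fromℕ n

  dominatedBy-inject₁⁺ : ∀ {v} → DominatedBy (deleteLast G) S v → DominatedBy G (S ∷ʳ b) (inject₁ v)
  dominatedBy-inject₁⁺ (inj₁ v∈S) = inj₁ (inject₁-∈-∷ʳ⁺ v∈S)
  dominatedBy-inject₁⁺ (inj₂ (u , u∈S , uv)) = inj₂ (inject₁ u , inject₁-∈-∷ʳ⁺ u∈S , uv)

  dominatedBy-inject₁⁻ : ∀ {v} → DominatedBy G (S ∷ʳ b) (inject₁ v) →
    DominatedBy (deleteLast G) S v ⊎ (ℓ ∈ S ∷ʳ b × Adj G ℓ (inject₁ v))
  dominatedBy-inject₁⁻ (inj₁ v∈S) = inj₁ (inj₁ (inject₁-∈-∷ʳ⁻ v∈S))
  dominatedBy-inject₁⁻ (inj₂ (u , u∈S , uv)) with view u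
  ... | ‵fromℕ = inj₂ (u∈S , uv)
  ... | ‵inj₁ {i = u′} _ = inj₁ (inj₂ (u′ , inject₁-∈-∷ʳ⁻ u∈S , uv))

  dominatedBy-fromℕ⁻ : DominatedBy G (S ∷ʳ b) ℓ → ℓ ∈ S ∷ʳ b ⊎ ∃ λ u → u ∈ S × Adj G (inject₁ u) ℓ
  dominatedBy-fromℕ⁻ (inj₁ ℓ∈S) = inj₁ ℓ∈S
  dominatedBy-fromℕ⁻ (inj₂ (u , u∈S , uℓ)) with view u
  ... | ‵fromℕ = ⊥-elim (irrefl G uℓ)
  ... | ‵inj₁ {i = u′} _ = inj₂ (u′ , inject₁-∈-∷ʳ⁻ u∈S , uℓ)

  dominating-∷ʳ : DominatedBy G (S ∷ʳ b) ℓ → Dominating (deleteLast G) S → Dominating G (S ∷ʳ b)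
  dominating-∷ʳ dℓ d v with view v
  ... | ‵fromℕ = dℓ
  ... | ‵inj₁ {i = v′} _ = dominatedBy-inject₁⁺ (d v′)

module _ {n} (G : Graph (suc n)) where

  private
    ℓ = fromℕ n
    G′ = deleteLast G

  module IsolatedLast (isolated : ∀ v → ¬ Adj G (inject₁ v) ℓ) where

    ¬dominating-∷ʳoutside : ∀ S → ¬ Dominating G (S ∷ʳ outside)
    ¬dominating-∷ʳoutside S d with dominatedBy-fromℕ⁻ G (d ℓ)
    ... | inj₁ ℓ∈S = fromℕ-∉-∷ʳoutside S ℓ∈S
    ... | inj₂ (u , _ , uℓ) = isolated u uℓ

    dominating-∷ʳinside : (Dominating G ∘ (_∷ʳ inside)) ≐ Dominating G′
    dominating-∷ʳinside = restrict , λ {S} → dominating-∷ʳ G (inj₁ (fromℕ-∈-∷ʳinside S))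
      where
      restrict : ∀ {S} → Dominating G (S ∷ʳ inside) → Dominating G′ S
      restrict d v with dominatedBy-inject₁⁻ G (d (inject₁ v))
      ... | inj₁ dv = dv
      ... | inj₂ (_ , ℓv) = ⊥-elim (isolated v (Graph.sym G ℓv))

  module UniversalLast (universal : ∀ v → Adj G (inject₁ v) ℓ) where

    dominating-∷ʳinside : ∀ S → Dominating G (S ∷ʳ inside)
    dominating-∷ʳinside S v with view v
    ... | ‵fromℕ = inj₁ (fromℕ-∈-∷ʳinside S)
    ... | ‵inj₁ {i = v′} _ = inj₂ (ℓ , fromℕ-∈-∷ʳinside S , Graph.sym G (universal v′))

    dominating-∷ʳoutside : (Dominating G ∘ (_∷ʳ outside)) ≐ (λ S → Dominating G′ S × Nonempty S)
    dominating-∷ʳoutside = (λ d → restrict d , nonempty d) , extend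
      where
      restrict : ∀ {S} → Dominating G (S ∷ʳ outside) → Dominating G′ S
      restrict {S} d v with dominatedBy-inject₁⁻ G (d (inject₁ v))
      ... | inj₁ dv = dv
      ... | inj₂ (ℓ∈S , _) = ⊥-elim (fromℕ-∉-∷ʳoutside S ℓ∈S)
      nonempty : ∀ {S} → Dominating G (S ∷ʳ outside) → Nonempty S
      nonempty {S} d with dominatedBy-fromℕ⁻ G (d ℓ)
      ... | inj₁ ℓ∈S = ⊥-elim (fromℕ-∉-∷ʳoutside S ℓ∈S)
      ... | inj₂ (u , u∈S , _) = u , u∈S
      extend : ∀ {S} → Dominating G′ S × Nonempty S → Dominating G (S ∷ʳ outside)
      extend (d , u , u∈S) = dominating-∷ʳ G (inj₂ (inject₁ u , inject₁-∈-∷ʳ⁺ u∈S , universal u)) d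

  D-isolatedLast : (∀ v → ¬ Adj G (inject₁ v) ℓ) → D G ≗ shift (D G′)
  D-isolatedLast isolated k = begin
    D G k
      ≡⟨ sizePoly-∷ʳ (dominating? G) k ⟩
    sizePoly (dominating? G ∘ (_∷ʳ outside)) k + shift (sizePoly (dominating? G ∘ (_∷ʳ inside))) k
      ≡⟨ cong₂ _+_ (sizePoly-∅ (dominating? G ∘ (_∷ʳ outside)) ¬dominating-∷ʳoutside k)
                   (shift-cong (sizePoly-cong (dominating? G ∘ (_∷ʳ inside)) (dominating? G′) dominating-∷ʳinside) k) ⟩
    shift (D G′) k ∎
    where
    open ≡-Reasoning
    open IsolatedLast isolated

  D-universalLast : (∀ v → Adj G (inject₁ v) ℓ) →
    D G ≗ (sizePoly (dominating? G ∘ (_∷ʳ outside)) +P shift ((1P +P X) ^P n))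
  D-universalLast universal k =
    trans (sizePoly-∷ʳ (dominating? G) k)
          (cong (sizePoly (dominating? G ∘ (_∷ʳ outside)) k +_)
                (shift-cong (sizePoly-full (dominating? G ∘ (_∷ʳ inside)) dominating-∷ʳinside) k))
    where open UniversalLast universal

-- The right-hand side

tabulate-∷ʳ : ∀ {A : Set} {n} (f : Fin (suc n) → A) → tabulate f ≡ tabulate (f ∘ inject₁) ∷ʳ f (fromℕ n)
tabulate-∷ʳ {n = zero} f = refl
tabulate-∷ʳ {n = suc n} f = cong (f zero ∷_) (tabulate-∷ʳ (f ∘ suc))

tabulate-const : ∀ {A : Set} {n} (x : A) → tabulate {n = n} (const x) ≡ replicate n x
tabulate-const x = trans (tabulate-allFin (const x)) (map-const _ x)

allFin-∷ʳ : ∀ n → allFin (suc n) ≡ map inject₁ (allFin n) ++ [ fromℕ n ]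
allFin-∷ʳ n = trans (List-tabulate-∷ʳ id) (cong (_++ [ fromℕ n ]) (sym (map-tabulate id inject₁)))
  where
  List-tabulate-∷ʳ : ∀ {A : Set} {n} (f : Fin (suc n) → A) →
    List.tabulate f ≡ List.tabulate (f ∘ inject₁) ++ [ f (fromℕ n) ]
  List-tabulate-∷ʳ {n = zero} f = refl
  List-tabulate-∷ʳ {n = suc n} f = cong (f zero ∷_) (List-tabulate-∷ʳ (f ∘ suc))

∣p∷ʳinside∣≡1+∣p∣ : ∀ {n} (p : Subset n) → ∣ p ∷ʳ inside ∣ ≡ suc ∣ p ∣
∣p∷ʳinside∣≡1+∣p∣ [] = refl
∣p∷ʳinside∣≡1+∣p∣ (outside ∷ p) = ∣p∷ʳinside∣≡1+∣p∣ p
∣p∷ʳinside∣≡1+∣p∣ (inside ∷ p) = cong suc (∣p∷ʳinside∣≡1+∣p∣ p)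

∣p∷ʳoutside∣≡∣p∣ : ∀ {n} (p : Subset n) → ∣ p ∷ʳ outside ∣ ≡ ∣ p ∣
∣p∷ʳoutside∣≡∣p∣ [] = refl
∣p∷ʳoutside∣≡∣p∣ (outside ∷ p) = ∣p∷ʳoutside∣≡∣p∣ p
∣p∷ʳoutside∣≡∣p∣ (inside ∷ p) = cong suc (∣p∷ʳoutside∣≡∣p∣ p)

inject₁<fromℕ : ∀ {n} (i : Fin n) → inject₁ i < fromℕ n
inject₁<fromℕ {n} i = subst (toℕ (inject₁ i) ℕ.<_) (sym (toℕ-fromℕ n)) (inject₁ℕ< i)

before-inject₁ : ∀ {n} (t : Fin n) → before (inject₁ t) ≡ before t ∷ʳ outside
before-inject₁ {n} t = trans (tabulate-∷ʳ (λ j → toℕ j <ᵇ toℕ (inject₁ t))) (cong₂ _∷ʳ_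
  (tabulate-cong λ j → cong₂ _<ᵇ_ (toℕ-inject₁ j) (toℕ-inject₁ t))
  (dec-false (toℕ (fromℕ n) <? toℕ (inject₁ t)) (<-asym (inject₁<fromℕ t))))

∣before-inject₁∣ : ∀ {n} (t : Fin n) → ∣ before (inject₁ t) ∣ ≡ ∣ before t ∣
∣before-inject₁∣ t = trans (cong ∣_∣ (before-inject₁ t)) (∣p∷ʳoutside∣≡∣p∣ (before t))

∣before-fromℕ∣ : ∀ n → ∣ before (fromℕ n) ∣ ≡ n
∣before-fromℕ∣ n = begin
  ∣ before (fromℕ n) ∣
    ≡⟨ cong (∣_∣ {n = suc n}) (tabulate-∷ʳ {n = n} (λ j → toℕ j <ᵇ toℕ (fromℕ n))) ⟩
  ∣ tabulate {n = n} (λ j → toℕ (inject₁ j) <ᵇ toℕ (fromℕ n)) ∷ʳ (toℕ (fromℕ n) <ᵇ toℕ (fromℕ n)) ∣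
    ≡⟨ cong (∣_∣ {n = suc n}) (cong₂ _∷ʳ_
         (tabulate-cong (λ j → dec-true (toℕ (inject₁ j) <? toℕ (fromℕ n)) (inject₁<fromℕ j)))
         (dec-false (toℕ (fromℕ n) <? toℕ (fromℕ n)) (<-irrefl refl))) ⟩
  ∣ tabulate {n = n} (const inside) ∷ʳ outside ∣
    ≡⟨ ∣p∷ʳoutside∣≡∣p∣ (tabulate {n = n} (const inside)) ⟩
  ∣ tabulate {n = n} (const inside) ∣
    ≡⟨ cong (∣_∣ {n = n}) (tabulate-const inside) ⟩
  ∣ ⊤ {n} ∣
    ≡⟨ ∣⊤∣≡n n ⟩
  n ∎
  where open ≡-Reasoning

module _ {n} (side : Fin (suc n) → Bool) where

  private
    ℓ = fromℕ n
    side′ = side ∘ inject₁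

  isolatedSide-∷ʳ : ∀ {b} → side ℓ ≡ b → isolatedSide side ≡ isolatedSide side′ ∷ʳ not b
  isolatedSide-∷ʳ refl = tabulate-∷ʳ (not ∘ side)

  isolatedAfter-inject₁ : ∀ {b} → side ℓ ≡ b → ∀ t → isolatedAfter side (inject₁ t) ≡ isolatedAfter side′ t ∷ʳ not b
  isolatedAfter-inject₁ refl t =
    trans (tabulate-∷ʳ (λ j → if toℕ (inject₁ t) <ᵇ toℕ j then not (side j) else false)) (cong₂ _∷ʳ_
      (tabulate-cong λ j → cong₂ (λ a b → if a <ᵇ b then not (side (inject₁ j)) else false)
                                   (toℕ-inject₁ t) (toℕ-inject₁ j))
      (cong (if_then not (side ℓ) else false) (dec-true (toℕ (inject₁ t) <? toℕ ℓ) (inject₁<fromℕ t))))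

  ∣isolatedAfter-fromℕ∣ : ∣ isolatedAfter side ℓ ∣ ≡ 0
  ∣isolatedAfter-fromℕ∣ = begin
    ∣ isolatedAfter side ℓ ∣
      ≡⟨ cong (∣_∣ {n = suc n}) (tabulate-cong λ j →
           cong (if_then not (side j) else false) (dec-false (toℕ ℓ <? toℕ j) (≤⇒≯ (≤fromℕ j)))) ⟩
    ∣ tabulate {n = suc n} (const outside) ∣
      ≡⟨ cong (∣_∣ {n = suc n}) (tabulate-const outside) ⟩
    ∣ ⊥ {n = suc n} ∣
      ≡⟨ ∣⊥∣≡0 (suc n) ⟩
    0 ∎
    where open ≡-Reasoning

xᵅ[1+x]ᵝ : ℕ → ℕ → Poly
xᵅ[1+x]ᵝ α β = (X ^P α) *P ((1P +P X) ^P β)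

xᵅ[1+x]ᵝ-suc : ∀ α β → xᵅ[1+x]ᵝ (suc α) β ≗ shift (xᵅ[1+x]ᵝ α β)
xᵅ[1+x]ᵝ-suc α β = X^suc-*P α ((1P +P X) ^P β)

-- thresholdRHS T side is dominatingSum side +P isolatedTerm (dominating? T I) I by
-- definition, with I = isolatedSide side.
dominatingTerm : ∀ {n} → (Fin n → Bool) → Fin n → Poly
dominatingTerm side t = xᵅ[1+x]ᵝ (∣ isolatedAfter side t ∣ + 1) (∣ before t ∣)

dominatingSum : ∀ {n} → (Fin n → Bool) → Poly
dominatingSum {n} side = ΣP (filter (λ t → side t Bool.≟ true) (allFin n)) (dominatingTerm side)

isolatedTerm : ∀ {n} {P : Set} → Dec P → Subset n → Poly
isolatedTerm p? I k = indicator p? * (X ^P ∣ I ∣) k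

module _ {n} (side : Fin (suc n) → Bool) where

  private
    ℓ = fromℕ n
    side′ = side ∘ inject₁
    onDominatingSide? = λ (t : Fin (suc n)) → side t Bool.≟ true
    ts = filter (onDominatingSide? ∘ inject₁) (allFin n)

  dominatingTerm-fromℕ : dominatingTerm side ℓ ≗ shift ((1P +P X) ^P n)
  dominatingTerm-fromℕ k = begin
    dominatingTerm side ℓ k
      ≡⟨ cong₂ (λ α β → xᵅ[1+x]ᵝ (α + 1) β k) (∣isolatedAfter-fromℕ∣ side) (∣before-fromℕ∣ n) ⟩
    xᵅ[1+x]ᵝ 1 n k
      ≡⟨ xᵅ[1+x]ᵝ-suc 0 n k ⟩
    shift (1P *P ((1P +P X) ^P n)) k
      ≡⟨ shift-cong (*P-identityˡ ((1P +P X) ^P n)) k ⟩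
    shift ((1P +P X) ^P n) k ∎
    where open ≡-Reasoning

  dominatingSum-∷ʳ : dominatingSum side ≗
    (ΣP ts (dominatingTerm side ∘ inject₁) +P ΣP (filter onDominatingSide? [ ℓ ]) (dominatingTerm side))
  dominatingSum-∷ʳ k = begin
    dominatingSum side k
      ≡⟨ cong (λ us → ΣP (filter onDominatingSide? us) (dominatingTerm side) k) (allFin-∷ʳ n) ⟩
    ΣP (filter onDominatingSide? (inits ++ [ ℓ ])) (dominatingTerm side) k
      ≡⟨ cong (λ us → ΣP us (dominatingTerm side) k) (filter-++ onDominatingSide? inits [ ℓ ]) ⟩
    ΣP (filter onDominatingSide? inits ++ filter onDominatingSide? [ ℓ ]) (dominatingTerm side) k
      ≡⟨ ΣP-++ (filter onDominatingSide? inits) _ (dominatingTerm side) k ⟩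
    ΣP (filter onDominatingSide? inits) (dominatingTerm side) k + last
      ≡⟨ cong (λ us → ΣP us (dominatingTerm side) k + last) (filter-map onDominatingSide? inject₁ (allFin n)) ⟩
    ΣP (map inject₁ ts) (dominatingTerm side) k + last
      ≡⟨ cong (λ p → p k + last) (foldr-map _ inject₁ 0P ts) ⟩
    ΣP ts (dominatingTerm side ∘ inject₁) k + last ∎
    where
    open ≡-Reasoning
    inits = map inject₁ (allFin n)
    last = ΣP (filter onDominatingSide? [ ℓ ]) (dominatingTerm side) k

  dominatingSum-isolatedLast : side ℓ ≡ false → dominatingSum side ≗ shift (dominatingSum side′)
  dominatingSum-isolatedLast ℓ-isolated k = begin
    dominatingSum side k
      ≡⟨ dominatingSum-∷ʳ k ⟩
    ΣP ts (dominatingTerm side ∘ inject₁) k + ΣP (filter onDominatingSide? [ ℓ ]) (dominatingTerm side) k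
      ≡⟨ cong₂ _+_ (ΣP-cong ts shifted k)
                   (cong (λ us → ΣP us (dominatingTerm side) k) (filter-reject onDominatingSide? (not-¬ ℓ-isolated))) ⟩
    ΣP ts (shift ∘ dominatingTerm side′) k + 0
      ≡⟨ +-identityʳ _ ⟩
    ΣP ts (shift ∘ dominatingTerm side′) k
      ≡⟨ ΣP-shift ts (dominatingTerm side′) k ⟩
    shift (dominatingSum side′) k ∎
    where
    open ≡-Reasoning
    shifted : ∀ t → dominatingTerm side (inject₁ t) ≗ shift (dominatingTerm side′ t)
    shifted t k = begin
      dominatingTerm side (inject₁ t) k
        ≡⟨ cong₂ (λ α β → xᵅ[1+x]ᵝ (α + 1) β k)
                 (trans (cong ∣_∣ (isolatedAfter-inject₁ side ℓ-isolated t)) (∣p∷ʳinside∣≡1+∣p∣ (isolatedAfter side′ t)))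
                 (∣before-inject₁∣ t) ⟩
      xᵅ[1+x]ᵝ (suc (∣ isolatedAfter side′ t ∣ + 1)) (∣ before t ∣) k
        ≡⟨ xᵅ[1+x]ᵝ-suc (∣ isolatedAfter side′ t ∣ + 1) (∣ before t ∣) k ⟩
      shift (dominatingTerm side′ t) k ∎

  dominatingSum-universalLast : side ℓ ≡ true →
    dominatingSum side ≗ (dominatingSum side′ +P shift ((1P +P X) ^P n))
  dominatingSum-universalLast ℓ-dominating k = begin
    dominatingSum side k
      ≡⟨ dominatingSum-∷ʳ k ⟩
    ΣP ts (dominatingTerm side ∘ inject₁) k + ΣP (filter onDominatingSide? [ ℓ ]) (dominatingTerm side) k
      ≡⟨ cong₂ _+_ (ΣP-cong ts unchanged k)
                   (cong (λ us → ΣP us (dominatingTerm side) k) (filter-accept onDominatingSide? ℓ-dominating)) ⟩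
    dominatingSum side′ k + (dominatingTerm side ℓ k + 0)
      ≡⟨ cong (dominatingSum side′ k +_) (trans (+-identityʳ _) (dominatingTerm-fromℕ k)) ⟩
    dominatingSum side′ k + shift ((1P +P X) ^P n) k ∎
    where
    open ≡-Reasoning
    unchanged : ∀ t → dominatingTerm side (inject₁ t) ≗ dominatingTerm side′ t
    unchanged t k = cong₂ (λ α β → xᵅ[1+x]ᵝ (α + 1) β k)
      (trans (cong ∣_∣ (isolatedAfter-inject₁ side ℓ-dominating t)) (∣p∷ʳoutside∣≡∣p∣ (isolatedAfter side′ t)))
      (∣before-inject₁∣ t)

indicator-cong : ∀ {P Q : Set} (p? : Dec P) (q? : Dec Q) → (P → Q) → (Q → P) → indicator p? ≡ indicator q?
indicator-cong (yes _) (yes _) _ _ = refl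
indicator-cong (yes p) (no ¬q) P→Q _ = ⊥-elim (¬q (P→Q p))
indicator-cong (no ¬p) (yes q) _ Q→P = ⊥-elim (¬p (Q→P q))
indicator-cong (no _) (no _) _ _ = refl

indicator-no : ∀ {P : Set} (p? : Dec P) → ¬ P → indicator p? ≡ 0
indicator-no (yes p) ¬p = ⊥-elim (¬p p)
indicator-no (no _) _ = refl

module _ {n} {P : Set} (p? : Dec P) (I : Subset n) where

  isolatedTerm-∷ʳinside : isolatedTerm p? (I ∷ʳ inside) ≗ shift (isolatedTerm p? I)
  isolatedTerm-∷ʳinside k = begin
    indicator p? * (X ^P ∣ I ∷ʳ inside ∣) k ≡⟨ cong (λ a → indicator p? * (X ^P a) k) (∣p∷ʳinside∣≡1+∣p∣ I) ⟩
    indicator p? * (X *P (X ^P ∣ I ∣)) k     ≡⟨ cong (indicator p? *_) (X-*P (X ^P ∣ I ∣) k) ⟩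
    indicator p? * shift (X ^P ∣ I ∣) k      ≡⟨ scale k ⟩
    shift (isolatedTerm p? I) k              ∎
    where
    open ≡-Reasoning
    scale : ∀ k → indicator p? * shift (X ^P ∣ I ∣) k ≡ shift (isolatedTerm p? I) k
    scale zero = *-zeroʳ (indicator p?)
    scale (suc k) = refl

  isolatedTerm-∷ʳoutside : isolatedTerm p? (I ∷ʳ outside) ≗ isolatedTerm p? I
  isolatedTerm-∷ʳoutside k = cong (λ a → indicator p? * (X ^P a) k) (∣p∷ʳoutside∣≡∣p∣ I)

module _ {n} (T : Graph (suc n)) (side : Fin (suc n) → Bool) where

  private
    ℓ = fromℕ n
    T′ = deleteLast T
    side′ = side ∘ inject₁
    I′ = isolatedSide side′

  threshold-deleteLast : IsThresholdOrdering T side → IsThresholdOrdering T′ side′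
  threshold-deleteLast th i j i<j =
    th (inject₁ i) (inject₁ j) (subst₂ ℕ._<_ (sym (toℕ-inject₁ i)) (sym (toℕ-inject₁ j)) i<j)

  threshold-isolatedLast : IsThresholdOrdering T side → side ℓ ≡ false → ∀ v → ¬ Adj T (inject₁ v) ℓ
  threshold-isolatedLast th ℓ-isolated v = proj₂ (th (inject₁ v) ℓ (inject₁<fromℕ v)) ℓ-isolated

  threshold-universalLast : IsThresholdOrdering T side → side ℓ ≡ true → ∀ v → Adj T (inject₁ v) ℓ
  threshold-universalLast th ℓ-dominating v = proj₁ (th (inject₁ v) ℓ (inject₁<fromℕ v)) ℓ-dominating

  thresholdRHS-∷ʳ : ∀ {b} → side ℓ ≡ b →
    thresholdRHS T side ≗ (dominatingSum side +P isolatedTerm (dominating? T (I′ ∷ʳ not b)) (I′ ∷ʳ not b))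
  thresholdRHS-∷ʳ ℓ-side k =
    cong (λ I → dominatingSum side k + isolatedTerm (dominating? T I) I k) (isolatedSide-∷ʳ side ℓ-side)

  thresholdRHS-isolatedLast : side ℓ ≡ false → (∀ v → ¬ Adj T (inject₁ v) ℓ) →
    thresholdRHS T side ≗ shift (thresholdRHS T′ side′)
  thresholdRHS-isolatedLast ℓ-isolated isolated k = begin
    thresholdRHS T side k
      ≡⟨ thresholdRHS-∷ʳ ℓ-isolated k ⟩
    dominatingSum side k + isolatedTerm (dominating? T (I′ ∷ʳ inside)) (I′ ∷ʳ inside) k
      ≡⟨ cong₂ _+_ (dominatingSum-isolatedLast side ℓ-isolated k)
                   (isolatedTerm-∷ʳinside (dominating? T (I′ ∷ʳ inside)) I′ k) ⟩
    shift (dominatingSum side′) k + shift (isolatedTerm (dominating? T (I′ ∷ʳ inside)) I′) k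
      ≡⟨ cong (λ e → shift (dominatingSum side′) k + shift (λ k → e * (X ^P ∣ I′ ∣) k) k)
              (indicator-cong (dominating? T (I′ ∷ʳ inside)) (dominating? T′ I′)
                              (proj₁ dominating-∷ʳinside) (proj₂ dominating-∷ʳinside)) ⟩
    shift (dominatingSum side′) k + shift (isolatedTerm (dominating? T′ I′) I′) k
      ≡⟨ shift-+P (dominatingSum side′) (isolatedTerm (dominating? T′ I′) I′) k ⟨
    shift (thresholdRHS T′ side′) k ∎
    where
    open ≡-Reasoning
    open IsolatedLast T isolated

  thresholdRHS-universalLast : side ℓ ≡ true →
    thresholdRHS T side ≗
      ((dominatingSum side′ +P isolatedTerm (dominating? T (I′ ∷ʳ outside)) I′) +P shift ((1P +P X) ^P n))
  thresholdRHS-universalLast ℓ-dominating k = begin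
    thresholdRHS T side k
      ≡⟨ thresholdRHS-∷ʳ ℓ-dominating k ⟩
    dominatingSum side k + isolatedTerm (dominating? T (I′ ∷ʳ outside)) (I′ ∷ʳ outside) k
      ≡⟨ cong₂ _+_ (dominatingSum-universalLast side ℓ-dominating k)
                   (isolatedTerm-∷ʳoutside (dominating? T (I′ ∷ʳ outside)) I′ k) ⟩
    dominatingSum side′ k + shift ((1P +P X) ^P n) k + isolatedTerm (dominating? T (I′ ∷ʳ outside)) I′ k
      ≡⟨ xy∙z≈xz∙y (dominatingSum side′ k) _ _ ⟩
    dominatingSum side′ k + isolatedTerm (dominating? T (I′ ∷ʳ outside)) I′ k + shift ((1P +P X) ^P n) k ∎
    where open ≡-Reasoning

-- When n = 0 the empty set dominates T′ but not T.
D-avoidingUniversalLast : ∀ n (T : Graph (suc n)) (side : Fin (suc n) → Bool) →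
  (∀ v → Adj T (inject₁ v) (fromℕ n)) →
  D (deleteLast T) ≗ thresholdRHS (deleteLast T) (side ∘ inject₁) →
  let I′ = isolatedSide (side ∘ inject₁) in
  sizePoly (dominating? T ∘ (_∷ʳ outside)) ≗
    (dominatingSum (side ∘ inject₁) +P isolatedTerm (dominating? T (I′ ∷ʳ outside)) I′)
D-avoidingUniversalLast zero T side universal _ k =
  trans (sizePoly-∅ (dominating? T ∘ (_∷ʳ outside)) ¬dominating k)
        (cong (λ e → e * (X ^P 0) k) (sym (indicator-no (dominating? T ([] ∷ʳ outside)) (¬dominating []))))
  where
  open UniversalLast T universal
  ¬dominating : ∀ S → ¬ Dominating T (S ∷ʳ outside)
  ¬dominating S d with proj₁ dominating-∷ʳoutside d
  ... | _ , () , _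
D-avoidingUniversalLast (suc n) T side universal formula k = begin
  sizePoly (dominating? T ∘ (_∷ʳ outside)) k
    ≡⟨ sizePoly-cong (dominating? T ∘ (_∷ʳ outside)) (dominating? T′) (restrict , extend) k ⟩
  D T′ k
    ≡⟨ formula k ⟩
  dominatingSum side′ k + indicator (dominating? T′ I′) * (X ^P ∣ I′ ∣) k
    ≡⟨ cong (λ e → dominatingSum side′ k + e * (X ^P ∣ I′ ∣) k)
            (indicator-cong (dominating? T′ I′) (dominating? T (I′ ∷ʳ outside)) extend restrict) ⟩
  dominatingSum side′ k + isolatedTerm (dominating? T (I′ ∷ʳ outside)) I′ k ∎
  where
  open ≡-Reasoning
  open UniversalLast T universal
  T′ = deleteLast T
  side′ = side ∘ inject₁
  I′ = isolatedSide side′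
  restrict : ∀ {S} → Dominating T (S ∷ʳ outside) → Dominating T′ S
  restrict = proj₁ ∘ proj₁ dominating-∷ʳoutside
  extend : ∀ {S} → Dominating T′ S → Dominating T (S ∷ʳ outside)
  extend d = proj₂ dominating-∷ʳoutside (d , dominating-nonempty T′ d)

module _ {n} (T : Graph (suc n)) (side : Fin (suc n) → Bool) (th : IsThresholdOrdering T side) where

  private
    T′ = deleteLast T
    side′ = side ∘ inject₁

  formula-isolatedLast : side (fromℕ n) ≡ false → D T′ ≗ thresholdRHS T′ side′ → D T ≗ thresholdRHS T side
  formula-isolatedLast ℓ-isolated formula k = begin
    D T k                             ≡⟨ D-isolatedLast T isolated k ⟩
    shift (D T′) k                    ≡⟨ shift-cong formula k ⟩
    shift (thresholdRHS T′ side′) k   ≡⟨ thresholdRHS-isolatedLast T side ℓ-isolated isolated k ⟨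
    thresholdRHS T side k             ∎
    where
    open ≡-Reasoning
    isolated = threshold-isolatedLast T side th ℓ-isolated

  formula-universalLast : side (fromℕ n) ≡ true → D T′ ≗ thresholdRHS T′ side′ → D T ≗ thresholdRHS T side
  formula-universalLast ℓ-dominating formula k = begin
    D T k
      ≡⟨ D-universalLast T universal k ⟩
    sizePoly (dominating? T ∘ (_∷ʳ outside)) k + shift B k
      ≡⟨ cong (_+ shift B k) (D-avoidingUniversalLast n T side universal formula k) ⟩
    dominatingSum side′ k + isolatedTerm (dominating? T (I′ ∷ʳ outside)) I′ k + shift B k
      ≡⟨ thresholdRHS-universalLast T side ℓ-dominating k ⟨
    thresholdRHS T side k ∎
    where
    open ≡-Reasoning
    I′ = isolatedSide side′
    B = (1P +P X) ^P n
    universal = threshold-universalLast T side th ℓ-dominating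

lemma18 : (n : ℕ) (T : Graph n) (side : Fin n → Bool) →
    IsThresholdOrdering T side →
    ∀ k → D T k ≡ thresholdRHS T side k
lemma18 zero T side th zero = refl
lemma18 zero T side th (suc k) = refl
lemma18 (suc n) T side th
  with side (fromℕ n) in ℓ-side | lemma18 n (deleteLast T) (side ∘ inject₁) (threshold-deleteLast T side th)
... | false | formula′ = formula-isolatedLast T side th ℓ-side formula′
... | true  | formula′ = formula-universalLast T side th ℓ-side formula′
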